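{- Let $\phi\in\mathcal L^{[:=]}_x$. If $\vdash[x:=a](\phi\to\mathsf K_x[x:=a]\phi)$ for every $a\in\mathbf A$, then $\vdash\mathsf K_\phi\alpha\to\mathsf K_\phi\mathsf K_\phi\alpha$ for every sentence $\alpha\in\mathcal L^{[:=]}_0$, where $\vdash$ denotes provability in $\mathbf{LEL}^{[:=]}$.
   Context: Fix a nonempty finite set $\mathbf{A}$ of agents, a countable set $\mathbf{X}$ of variables with $\mathbf A\cap\mathbf X=\emptyset$, and a countable set $\mathbf{P}$ of predicate letters. Formulas of $\mathcal{L}^{[:=]}$ and free variables: $\phi ::= p_x \mid \top \mid \neg\phi \mid (\phi\wedge\phi) \mid [x:=a]\phi \mid \mathsf{K}_X\alpha$, with $p\in\mathbf P$, $x\in\mathbf X$, $a\in\mathbf A$, $X\subseteq\mathbf X$ finite (possibly empty), $\alpha$ a formula with no free variables (a sentence); $FV(p_x)=\{x\}$, $FV(\top)=\emptyset$, $FV$ commutes with Booleans, $FV([x:=a]\phi)=FV(\phi)\setminus\{x\}$, $FV(\mathsf K_X\alpha)=X$. Other Booleans as usual, $\bot:=\neg\top$, $\langle x:=a\rangle\phi:=\neg[x:=a]\neg\phi$. $\phi[y/x]$ replaces free occurrences of $x$ by $y$; admissible if $x$ has no free occurrence within the scope of any $[y:=b]$. For $\vec x=x_1,\dots,x_n$, $\vec a=a_1,\dots,a_n$: $[\vec x:=\vec a]\phi$ abbreviates $[x_1:=a_1]\cdots[x_n:=a_n]\phi$, $\mathsf K_{\vec x}$ abbreviates $\mathsf K_{\{x_1,\dots,x_n\}}$,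 $\mathsf K_x=\mathsf K_{\{x\}}$. $\mathcal L^{[:=]}_x$ is the set of formulas whose free variables are among $\{x\}$. For $\phi\in\mathcal L^{[:=]}_x$ and $A\subseteq\mathbf A$, $\phi!(A):=\bigwedge_{a\in A}\langle x:=a\rangle\phi\wedge\bigwedge_{b\in\mathbf A\setminus A}[x:=b]\neg\phi$, and $\mathsf K_\phi\alpha:=\bigwedge_{\{\vec a\}\subseteq\mathbf A}(\phi!(\{\vec a\})\to[\vec x:=\vec a]\mathsf K_{\vec x}\alpha)$, the conjunction ranging over all subsets $\{\vec a\}$ of $\mathbf A$ (each enumerated without repetition as $\vec a$, with $\vec x$ a sequence of distinct variables of the same length). $\mathbf{LEL}^{[:=]}$: axioms: propositional tautologies; $\mathsf K_X(\alpha\to\beta)\to(\mathsf K_X\alpha\to\mathsf K_X\beta)$; $\mathsf K_X\alpha\to\mathsf K_Y\alpha$ ($X\subseteq Y$); $[x:=a](\phi\to\psi)\to([x:=a]\phi\to[x:=a]\psi)$; $\langle x:=a\rangle\phi\to[x:=a]\phi$; $\phi\to[x:=a]\phi$ ($x\notin FV(\phi)$); $[y:=a]([x:=a]\phi\to\phi[y/x])$ ($\phi[y/x]$ admissible); $[x:=a][y:=b]\phi\to[y:=b][x:=a]\phi$ ($x\neq y$); $\bigwedge_{a\in\mathbf A}[x:=a]\phi\to\phi$; $\mathsf K_X\alpha\to\alpha$; $[\vec x:=\vec a](\neg\mathsf K_{\vec x}\alpha\to\mathsf K_{\vec x}[\vec x:=\vec a]\neg\mathsf K_{\vec x}\alpha)$;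 $[x:=a]\mathsf K_x\langle x:=a\rangle\top$; $[x:=a](p_x\to\mathsf K_x[x:=a]p_x)$; $[\vec x:=\vec a](\bigwedge_{b\in B}[x:=b]\bot\to\mathsf K_{\vec x}\bigwedge_{b\in B}[x:=b]\bot)$ with $B=\mathbf A\setminus\{\vec a\}$. Rules: modus ponens; from $\alpha$ infer $\mathsf K_\emptyset\alpha$; from $\phi$ infer $[x:=a]\phi$. -}

module Defs where

open import Data.Nat using (ℕ; zero; suc; _≟_)
open import Data.Fin using (Fin)
import Data.Fin as Fin
open import Data.Bool using (Bool; true; false; not; if_then_else_; _∧_)
open import Data.List using (List; []; _∷_; _++_; map; allFin; filterᵇ; length)
open import Data.List.Membership.Propositional using (_∈_; _∉_)
open import Data.List.Relation.Unary.Any using (here; there)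
open import Data.List.Relation.Unary.Unique.Propositional using (Unique)
open import Data.Product using (_×_; _,_; proj₁; proj₂)
open import Data.Unit using (⊤; tt)
open import Data.Empty using (⊥; ⊥-elim)
open import Relation.Nullary using (¬_; yes; no; does)
open import Relation.Binary.PropositionalEquality using (_≡_; refl; sym; trans; _≢_)

Var : Set
Var = ℕ

rem : Var → List Var → List Var
rem x [] = []
rem x (y ∷ ys) with x ≟ y
... | yes _ = rem x ys
... | no _ = y ∷ rem x ys

rem-sound : ∀ {y} x l → y ∈ rem x l → (y ∈ l) × (y ≢ x)
rem-sound x (z ∷ l) p with x ≟ z
... | yes _ = let r = rem-sound x l p in there (proj₁ r) , proj₂ r
... | no x≢z with p
...   | here y≡z = here y≡z , λ y≡x → x≢z (trans (sym y≡x) y≡z)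
...   | there q = let r = rem-sound x l q in there (proj₁ r) , proj₂ r

empty-list : {A : Set} (l : List A) → (∀ y → y ∉ l) → l ≡ []
empty-list [] f = refl
empty-list (z ∷ l) f = ⊥-elim (f z (here refl))

++-nil : {A : Set} {l m : List A} → l ≡ [] → m ≡ [] → l ++ m ≡ []
++-nil refl refl = refl

module LEL (n : ℕ) (Pred : Set) where

  Agent : Set
  Agent = Fin n

  -- Formulas (induction-recursion with the free-variable function, so that
  -- K_X α requires α to be a sentence).
  data Form : Set
  fv : Form → List Var

  infixr 6 _∧'_
  infixr 8 ¬'_
  infixr 8 [_≔_]_

  data Form where
    pr    : Pred → Var → Form
    ⊤'    : Form
    ¬'_   : Form → Form
    _∧'_  : Form → Form → Form
    [_≔_]_ : Var → Agent → Form → Form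
    K     : List Var → (α : Form) → .(fv α ≡ []) → Form

  fv (pr p x) = x ∷ []
  fv ⊤' = []
  fv (¬' φ) = fv φ
  fv (φ ∧' ψ) = fv φ ++ fv ψ
  fv ([ x ≔ a ] φ) = rem x (fv φ)
  fv (K X α _) = X

  Sentence : Form → Set
  Sentence α = fv α ≡ []

  InL : Var → Form → Set
  InL x φ = ∀ y → y ∈ fv φ → y ≡ x

  infixr 5 _⇒'_
  _⇒'_ : Form → Form → Form
  φ ⇒' ψ = ¬' (φ ∧' ¬' ψ)

  ⊥' : Form
  ⊥' = ¬' ⊤'

  ⟨_≔_⟩_ : Var → Agent → Form → Form
  ⟨ x ≔ a ⟩ φ = ¬' ([ x ≔ a ] (¬' φ))

  ⋀ : List Form → Form
  ⋀ [] = ⊤'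
  ⋀ (φ ∷ φs) = φ ∧' ⋀ φs

  assign : List (Var × Agent) → Form → Form
  assign [] φ = φ
  assign ((x , a) ∷ xs) φ = [ x ≔ a ] assign xs φ

  vars : List (Var × Agent) → List Var
  vars = map proj₁

  agents : List (Var × Agent) → List Agent
  agents = map proj₂

  sent-⇒ : ∀ {φ ψ : Form} → Sentence φ → Sentence ψ → Sentence (φ ⇒' ψ)
  sent-⇒ hφ hψ = ++-nil hφ hψ

  sent-⋀map : {B : Set} (f : B → Form) → (∀ b → Sentence (f b)) → ∀ l → Sentence (⋀ (map f l))
  sent-⋀map f h [] = refl
  sent-⋀map f h (b ∷ l) = ++-nil (h b) (sent-⋀map f h l)

  assign-fv : ∀ {y} xs ψ → y ∈ fv (assign xs ψ) → (y ∈ fv ψ) × ¬ (y ∈ vars xs)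
  assign-fv [] ψ p = p , λ ()
  assign-fv ((x , a) ∷ xs) ψ p with rem-sound x (fv (assign xs ψ)) p
  ... | q , y≢x with assign-fv xs ψ q
  ...   | r , ns = r , λ { (here e) → y≢x e ; (there t) → ns t }

  sent-assign : ∀ xs ψ → (∀ y → y ∈ fv ψ → y ∈ vars xs) → Sentence (assign xs ψ)
  sent-assign xs ψ h = empty-list _ (λ y p → let r = assign-fv xs ψ p in proj₂ r (h y (proj₁ r)))

  sent-bind : ∀ x a φ → InL x φ → Sentence ([ x ≔ a ] φ)
  sent-bind x a φ h = sent-assign ((x , a) ∷ []) φ (λ y p → here (h y p))

  sent-bind-var : ∀ (p : Pred) x a → Sentence ([ x ≔ a ] pr p x)
  sent-bind-var p x a = sent-bind x a (pr p x) (λ { y (here e) → e })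

  sent-assignK : ∀ xs α (h : Sentence α) → Sentence (assign xs (K (vars xs) α h))
  sent-assignK xs α h = sent-assign xs (K (vars xs) α h) (λ y p → p)

  sent-assign¬K : ∀ xs α (h : Sentence α) → Sentence (assign xs (¬' K (vars xs) α h))
  sent-assign¬K xs α h = sent-assign xs (¬' K (vars xs) α h) (λ y p → p)

  rn : Var → Var → Var → Var
  rn y x z = if does (z ≟ x) then y else z

  _[_/_] : Form → Var → Var → Form
  pr p z [ y / x ] = pr p (rn y x z)
  ⊤' [ y / x ] = ⊤'
  (¬' φ) [ y / x ] = ¬' (φ [ y / x ])
  (φ ∧' ψ) [ y / x ] = (φ [ y / x ]) ∧' (ψ [ y / x ])
  ([ z ≔ a ] φ) [ y / x ] with z ≟ x
  ... | yes _ = [ z ≔ a ] φ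
  ... | no _ = [ z ≔ a ] (φ [ y / x ])
  K X α h [ y / x ] = K (map (rn y x) X) α h

  -- φ[y/x] admissible: x has no free occurrence within the scope of any [y:=b]
  Adm : Var → Var → Form → Set
  Adm y x (pr p z) = ⊤
  Adm y x ⊤' = ⊤
  Adm y x (¬' φ) = Adm y x φ
  Adm y x (φ ∧' ψ) = Adm y x φ × Adm y x ψ
  Adm y x ([ z ≔ b ] φ) with z ≟ x | z ≟ y
  ... | yes _ | _ = ⊤
  ... | no _ | yes _ = x ∉ fv φ
  ... | no _ | no _ = Adm y x φ
  Adm y x (K X α h) = ⊤

  -- propositional tautologies: true under every Boolean valuation of the
  -- non-Boolean subformulas
  ev : (Form → Bool) → Form → Bool
  ev v ⊤' = true
  ev v (¬' φ) = not (ev v φ)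
  ev v (φ ∧' ψ) = ev v φ ∧ ev v ψ
  ev v φ = v φ

  Taut : Form → Set
  Taut φ = ∀ (v : Form → Bool) → ev v φ ≡ true

  memB : Agent → List Agent → Bool
  memB a [] = false
  memB a (b ∷ bs) = if does (a Fin.≟ b) then true else memB a bs

  compl : List Agent → List Agent
  compl as = filterᵇ (λ b → not (memB b as)) (allFin n)

  subsets : List Agent → List (List Agent)
  subsets [] = [] ∷ []
  subsets (a ∷ l) = subsets l ++ map (a ∷_) (subsets l)

  label : ℕ → List Agent → List (Var × Agent)
  label i [] = []
  label i (a ∷ as) = (i , a) ∷ label (suc i) as

  infix 2 ⊢_
  data ⊢_ : Form → Set where
    taut   : ∀ φ → Taut φ → ⊢ φ
    Kdist  : ∀ X α β (hα : Sentence α) (hβ : Sentence β) →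
             ⊢ K X (α ⇒' β) (sent-⇒ {α} {β} hα hβ) ⇒' (K X α hα ⇒' K X β hβ)
    Kmono  : ∀ X Y α (hα : Sentence α) → (∀ z → z ∈ X → z ∈ Y) →
             ⊢ K X α hα ⇒' K Y α hα
    Adist  : ∀ x a φ ψ → ⊢ [ x ≔ a ] (φ ⇒' ψ) ⇒' ([ x ≔ a ] φ ⇒' [ x ≔ a ] ψ)
    Afun   : ∀ x a φ → ⊢ ⟨ x ≔ a ⟩ φ ⇒' [ x ≔ a ] φ
    Avac   : ∀ x a φ → x ∉ fv φ → ⊢ φ ⇒' [ x ≔ a ] φ
    Asub   : ∀ x y a φ → Adm y x φ → ⊢ [ y ≔ a ] ([ x ≔ a ] φ ⇒' (φ [ y / x ]))
    Acomm  : ∀ x y a b φ → x ≢ y → ⊢ [ x ≔ a ] [ y ≔ b ] φ ⇒' [ y ≔ b ] [ x ≔ a ] φ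
    Aall   : ∀ x φ → ⊢ ⋀ (map (λ a → [ x ≔ a ] φ) (allFin n)) ⇒' φ
    KT     : ∀ X α (hα : Sentence α) → ⊢ K X α hα ⇒' α
    K5     : ∀ xs α (hα : Sentence α) → Unique (vars xs) →
             ⊢ assign xs (¬' K (vars xs) α hα ⇒'
                 K (vars xs) (assign xs (¬' K (vars xs) α hα)) (sent-assign¬K xs α hα))
    Kex    : ∀ x a → ⊢ [ x ≔ a ] K (x ∷ []) (⟨ x ≔ a ⟩ ⊤') refl
    Kpred  : ∀ x a p → ⊢ [ x ≔ a ] (pr p x ⇒' K (x ∷ []) ([ x ≔ a ] pr p x) (sent-bind-var p x a))
    Kabs   : ∀ xs x → Unique (vars xs) →
             ⊢ assign xs (⋀ (map (λ b → [ x ≔ b ] ⊥') (compl (agents xs))) ⇒'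
                 K (vars xs) (⋀ (map (λ b → [ x ≔ b ] ⊥') (compl (agents xs))))
                   (sent-⋀map (λ b → [ x ≔ b ] ⊥') (λ b → refl) (compl (agents xs))))
    mp     : ∀ {φ ψ} → ⊢ φ ⇒' ψ → ⊢ φ → ⊢ ψ
    nec    : ∀ {α} (hα : Sentence α) → ⊢ α → ⊢ K [] α hα
    gen    : ∀ {φ} x a → ⊢ φ → ⊢ [ x ≔ a ] φ

  bang : Var → Form → List Agent → Form
  bang x φ as = ⋀ (map (λ a → ⟨ x ≔ a ⟩ φ) as) ∧' ⋀ (map (λ b → [ x ≔ b ] ¬' φ) (compl as))

  sent-bang : ∀ x φ → InL x φ → ∀ as → Sentence (bang x φ as)
  sent-bang x φ h as =
    ++-nil (sent-⋀map (λ a → ⟨ x ≔ a ⟩ φ) (λ a → sent-bind x a φ h) as)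
           (sent-⋀map (λ b → [ x ≔ b ] ¬' φ) (λ b → sent-bind x b (¬' φ) h) (compl as))

  Kφ-clause : Var → Form → (α : Form) → Sentence α → List Agent → Form
  Kφ-clause x φ α hα as = bang x φ as ⇒' assign (label 0 as) (K (vars (label 0 as)) α hα)

  Kφ : (x : Var) (φ : Form) → InL x φ → (α : Form) → Sentence α → Form
  Kφ x φ hφ α hα = ⋀ (map (Kφ-clause x φ α hα) (subsets (allFin n)))

  sent-Kφ : ∀ x φ (hφ : InL x φ) α (hα : Sentence α) → Sentence (Kφ x φ hφ α hα)
  sent-Kφ x φ hφ α hα = sent-⋀map (Kφ-clause x φ α hα)
    (λ as → sent-⇒ {bang x φ as} {assign (label 0 as) (K (vars (label 0 as)) α hα)} (sent-bang x φ hφ as) (sent-assignK (label 0 as) α hα)) (subsets (allFin n))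

-- Fix a set A of agents with φ!(A), and let σ name the agents of A by distinct variables.
-- By the hypothesis on φ, each a ∈ A knows that it satisfies φ, so under σ the group knows
-- ⋀_{a ∈ A} ⟨x:=a⟩φ; by positive introspection (derived from T and 5, as in S5) it also knows
-- [σ]K_σ α.  Inside this knowledge K_φ α follows clause by clause: for B ⊇ A, distributed
-- knowledge of A transfers to B after renaming variables, and a B missing some a ∈ A is ruled
-- out because ⟨x:=a⟩φ contradicts the conjunct [x:=a]¬φ of φ!(B).
module Submission where

open import Defs
open import Data.Nat using (ℕ; zero; suc; _≤_; _<_; _+_; s≤s; _≟_)
open import Data.Nat.Properties using (≤-refl; ≤-trans; <-≤-trans; n≤1+n; m≤m+n; m≤n+m; +-suc; <⇒≢; <-irrefl)
open import Data.Fin using (Fin)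
import Data.Fin as Fin
open import Data.Bool using (Bool; true; false; not; _∧_; T; if_then_else_)
open import Data.Bool.Properties using (T-∧; T-≡)
open import Data.Vec using (Vec; []; _∷_; lookup)
import Data.Vec as Vec
open import Data.Vec.Properties using (lookup-map)
open import Data.List using (List; []; _∷_; _++_; map; length; allFin)
open import Data.List.Properties using (map-++; ++-assoc)
open import Data.List.Membership.Propositional using (_∈_; _∉_; find)
open import Data.List.Membership.Propositional.Properties using (∈-filter⁺; ∈-allFin; ∈-++⁺ˡ; ∈-++⁻; ∈-map⁻; ∈-map⁺)
open import Data.List.Relation.Unary.Any using (here; there)
open import Data.List.Relation.Unary.All using (all?)
import Data.List.Relation.Unary.All as All
open import Data.List.Relation.Unary.All.Properties using (¬All⇒Any¬; All¬⇒¬Any; ++⁻ˡ)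
open import Data.List.Relation.Unary.Unique.Propositional using (Unique)
open import Data.List.Relation.Unary.AllPairs using ([]; _∷_)
import Data.List.Relation.Unary.Unique.Propositional.Properties as Unique
open import Data.List.Relation.Binary.Disjoint.Propositional using (Disjoint)
import Data.List.Membership.DecPropositional as DecMembership
open import Data.Product using (Σ; _×_; _,_; proj₁; proj₂)
open import Data.Sum using (_⊎_; inj₁; inj₂; [_,_]′)
open import Data.Unit using (tt)
open import Data.Empty using (⊥-elim)
open import Function.Bundles using (_↣_; Equivalence)
open import Relation.Nullary using (yes; no; does; Dec)
open import Relation.Nullary.Decidable using (T?)
open import Relation.Binary.PropositionalEquality using (_≡_; refl; sym; trans; cong; cong₂; subst)

data Schema (k : ℕ) : Set where
  var  : Fin k → Schema k
  ⊤ˢ   : Schema k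
  ¬ˢ_  : Schema k → Schema k
  _∧ˢ_ : Schema k → Schema k → Schema k

infixr 8 ¬ˢ_
infixr 6 _∧ˢ_
infixr 5 _⇒ˢ_

_⇒ˢ_ : ∀ {k} → Schema k → Schema k → Schema k
s ⇒ˢ t = ¬ˢ (s ∧ˢ ¬ˢ t)

p₀ : ∀ {k} → Schema (suc k)
p₀ = var Fin.zero

p₁ : ∀ {k} → Schema (suc (suc k))
p₁ = var (Fin.suc Fin.zero)

p₂ : ∀ {k} → Schema (suc (suc (suc k)))
p₂ = var (Fin.suc (Fin.suc Fin.zero))

p₃ : ∀ {k} → Schema (suc (suc (suc (suc k))))
p₃ = var (Fin.suc (Fin.suc (Fin.suc Fin.zero)))

evalˢ : ∀ {k} → Vec Bool k → Schema k → Bool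
evalˢ ρ (var i)  = lookup ρ i
evalˢ ρ ⊤ˢ       = true
evalˢ ρ (¬ˢ s)   = not (evalˢ ρ s)
evalˢ ρ (s ∧ˢ t) = evalˢ ρ s ∧ evalˢ ρ t

forAllValuations : ∀ k → (Vec Bool k → Bool) → Bool
forAllValuations zero    f = f []
forAllValuations (suc k) f = forAllValuations k (λ ρ → f (true ∷ ρ)) ∧ forAllValuations k (λ ρ → f (false ∷ ρ))

forAllValuations-sound : ∀ k f → T (forAllValuations k f) → ∀ ρ → T (f ρ)
forAllValuations-sound zero    f t [] = t
forAllValuations-sound (suc k) f t (true ∷ ρ) =
  forAllValuations-sound k _ (proj₁ (Equivalence.to T-∧ t)) ρ
forAllValuations-sound (suc k) f t (false ∷ ρ) =
  forAllValuations-sound k _ (proj₂ (Equivalence.to T-∧ t)) ρ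

valid : ∀ {k} → Schema k → Bool
valid {k} s = forAllValuations k (λ ρ → evalˢ ρ s)

module Derivable (n : ℕ) (Pred : Set) where
  open LEL n Pred

  ⟦_⟧ : ∀ {k} → Schema k → Vec Form k → Form
  ⟦ var i ⟧  Γ = lookup Γ i
  ⟦ ⊤ˢ ⟧     Γ = ⊤'
  ⟦ ¬ˢ s ⟧   Γ = ¬' ⟦ s ⟧ Γ
  ⟦ s ∧ˢ t ⟧ Γ = ⟦ s ⟧ Γ ∧' ⟦ t ⟧ Γ

  ev-⟦⟧ : ∀ {k} v (s : Schema k) Γ → ev v (⟦ s ⟧ Γ) ≡ evalˢ (Vec.map (ev v) Γ) s
  ev-⟦⟧ v (var i)  Γ = sym (lookup-map i (ev v) Γ)
  ev-⟦⟧ v ⊤ˢ       Γ = refl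
  ev-⟦⟧ v (¬ˢ s)   Γ = cong not (ev-⟦⟧ v s Γ)
  ev-⟦⟧ v (s ∧ˢ t) Γ = cong₂ _∧_ (ev-⟦⟧ v s Γ) (ev-⟦⟧ v t Γ)

  -- For a valid s the certificate type T (valid s) computes to ⊤, so callers leave it to eta.
  tautology : ∀ {k} (s : Schema k) {_ : T (valid s)} (Γ : Vec Form k) → ⊢ ⟦ s ⟧ Γ
  tautology {k} s {valid-s} Γ = taut _ λ v →
    trans (ev-⟦⟧ v s Γ)
          (Equivalence.to T-≡ (forAllValuations-sound k _ valid-s (Vec.map (ev v) Γ)))

  mp₂ : ∀ {A B C} → ⊢ A ⇒' B ⇒' C → ⊢ A → ⊢ B → ⊢ C
  mp₂ p q r = mp (mp p q) r

  mp₃ : ∀ {A B C D} → ⊢ A ⇒' B ⇒' C ⇒' D → ⊢ A → ⊢ B → ⊢ C → ⊢ D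
  mp₃ p q r s = mp (mp₂ p q r) s

  ⊢⊤ : ⊢ ⊤'
  ⊢⊤ = taut ⊤' λ _ → refl

  ⇒-refl : ∀ A → ⊢ A ⇒' A
  ⇒-refl A = tautology (p₀ ⇒ˢ p₀) (A ∷ [])

  ⇒-trans : ∀ {A B C} → ⊢ A ⇒' B → ⊢ B ⇒' C → ⊢ A ⇒' C
  ⇒-trans {A} {B} {C} = mp₂ (tautology ((p₀ ⇒ˢ p₁) ⇒ˢ (p₁ ⇒ˢ p₂) ⇒ˢ p₀ ⇒ˢ p₂) (A ∷ B ∷ C ∷ []))

  ⇒-const : ∀ {A B} → ⊢ B → ⊢ A ⇒' B
  ⇒-const {A} {B} = mp (tautology (p₀ ⇒ˢ p₁ ⇒ˢ p₀) (B ∷ A ∷ []))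

  ∧-projˡ : ∀ A B → ⊢ A ∧' B ⇒' A
  ∧-projˡ A B = tautology (p₀ ∧ˢ p₁ ⇒ˢ p₀) (A ∷ B ∷ [])

  ∧-projʳ : ∀ A B → ⊢ A ∧' B ⇒' B
  ∧-projʳ A B = tautology (p₀ ∧ˢ p₁ ⇒ˢ p₁) (A ∷ B ∷ [])

  ⇒-∧ : ∀ {P A B} → ⊢ P ⇒' A → ⊢ P ⇒' B → ⊢ P ⇒' A ∧' B
  ⇒-∧ {P} {A} {B} = mp₂ (tautology ((p₀ ⇒ˢ p₁) ⇒ˢ (p₀ ⇒ˢ p₂) ⇒ˢ p₀ ⇒ˢ p₁ ∧ˢ p₂) (P ∷ A ∷ B ∷ []))

  ⇒-curry : ∀ {A B C} → ⊢ A ∧' B ⇒' C → ⊢ A ⇒' B ⇒' C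
  ⇒-curry {A} {B} {C} = mp (tautology ((p₀ ∧ˢ p₁ ⇒ˢ p₂) ⇒ˢ p₀ ⇒ˢ p₁ ⇒ˢ p₂) (A ∷ B ∷ C ∷ []))

  ⇒-uncurry : ∀ {A B C} → ⊢ A ⇒' B ⇒' C → ⊢ A ∧' B ⇒' C
  ⇒-uncurry {A} {B} {C} = mp (tautology ((p₀ ⇒ˢ p₁ ⇒ˢ p₂) ⇒ˢ p₀ ∧ˢ p₁ ⇒ˢ p₂) (A ∷ B ∷ C ∷ []))

  ⇒-combine : ∀ {A B C D} → ⊢ A ⇒' B → ⊢ A ⇒' C → ⊢ B ⇒' C ⇒' D → ⊢ A ⇒' D
  ⇒-combine {A} {B} {C} {D} = mp₃ (tautology
    ((p₀ ⇒ˢ p₁) ⇒ˢ (p₀ ⇒ˢ p₂) ⇒ˢ (p₁ ⇒ˢ p₂ ⇒ˢ p₃) ⇒ˢ p₀ ⇒ˢ p₃) (A ∷ B ∷ C ∷ D ∷ []))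

  [≔]-mono : ∀ x a {A B} → ⊢ A ⇒' B → ⊢ [ x ≔ a ] A ⇒' [ x ≔ a ] B
  [≔]-mono x a {A} {B} p = mp (Adist x a A B) (gen x a p)

  [≔]-mono₂ : ∀ x a {A B C} → ⊢ A ⇒' B ⇒' C → ⊢ [ x ≔ a ] A ⇒' [ x ≔ a ] B ⇒' [ x ≔ a ] C
  [≔]-mono₂ x a {A} {B} {C} p = ⇒-trans ([≔]-mono x a p) (Adist x a B C)

  [≔]-⟨≔⟩ : ∀ x a A → ⊢ [ x ≔ a ] A ⇒' ⟨ x ≔ a ⟩ ⊤' ⇒' ⟨ x ≔ a ⟩ A
  [≔]-⟨≔⟩ x a A = mp (tautology ((p₀ ⇒ˢ p₁ ⇒ˢ p₂) ⇒ˢ p₀ ⇒ˢ ¬ˢ p₂ ⇒ˢ ¬ˢ p₁)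
                                 ([ x ≔ a ] A ∷ [ x ≔ a ] ¬' A ∷ [ x ≔ a ] ⊥' ∷ []))
                     ([≔]-mono₂ x a (tautology (p₀ ⇒ˢ ¬ˢ p₀ ⇒ˢ ¬ˢ ⊤ˢ) (A ∷ [])))

  assign-gen : ∀ σ {A} → ⊢ A → ⊢ assign σ A
  assign-gen []            p = p
  assign-gen ((x , a) ∷ σ) p = gen x a (assign-gen σ p)

  assign-dist : ∀ σ A B → ⊢ assign σ (A ⇒' B) ⇒' assign σ A ⇒' assign σ B
  assign-dist []            A B = ⇒-refl (A ⇒' B)
  assign-dist ((x , a) ∷ σ) A B =
    ⇒-trans ([≔]-mono x a (assign-dist σ A B)) (Adist x a (assign σ A) (assign σ B))

  assign-mono : ∀ σ {A B} → ⊢ A ⇒' B → ⊢ assign σ A ⇒' assign σ B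
  assign-mono σ {A} {B} p = mp (assign-dist σ A B) (assign-gen σ p)

  assign-mono₂ : ∀ σ {A B C} → ⊢ A ⇒' B ⇒' C → ⊢ assign σ A ⇒' assign σ B ⇒' assign σ C
  assign-mono₂ σ {A} {B} {C} p = ⇒-trans (assign-mono σ p) (assign-dist σ B C)

  assign-map : ∀ σ {A B} → ⊢ A ⇒' B → ⊢ assign σ A → ⊢ assign σ B
  assign-map σ p = mp (assign-mono σ p)

  assign-⇒-trans : ∀ σ {A B C} → ⊢ assign σ (A ⇒' B) → ⊢ assign σ (B ⇒' C) → ⊢ assign σ (A ⇒' C)
  assign-⇒-trans σ {A} {B} {C} = mp₂ (assign-mono₂ σ (tautology
    ((p₀ ⇒ˢ p₁) ⇒ˢ (p₁ ⇒ˢ p₂) ⇒ˢ p₀ ⇒ˢ p₂) (A ∷ B ∷ C ∷ [])))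

  K-nec : ∀ X {A} (hA : Sentence A) → ⊢ A → ⊢ K X A hA
  K-nec X {A} hA p = mp (Kmono [] X A hA (λ _ ())) (nec hA p)

  K-mono : ∀ X {A B} (hA : Sentence A) (hB : Sentence B) → ⊢ A ⇒' B → ⊢ K X A hA ⇒' K X B hB
  K-mono X {A} {B} hA hB p = mp (Kdist X A B hA hB) (K-nec X (sent-⇒ {A} {B} hA hB) p)

  K-mono₂ : ∀ X {A B C} (hA : Sentence A) (hB : Sentence B) (hC : Sentence C) →
            ⊢ A ⇒' B ⇒' C → ⊢ K X A hA ⇒' K X B hB ⇒' K X C hC
  K-mono₂ X {A} {B} {C} hA hB hC p =
    ⇒-trans (K-mono X hA (sent-⇒ {B} {C} hB hC) p) (Kdist X B C hB hC)

  sentence-∉ : ∀ {A} → Sentence A → ∀ x → x ∉ fv A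
  sentence-∉ hA x x∈fv with subst (x ∈_) hA x∈fv
  ... | ()

  assign-vacuous : ∀ σ {A} → Sentence A → ⊢ A ⇒' assign σ A
  assign-vacuous []            {A} hA = ⇒-refl A
  assign-vacuous ((x , a) ∷ σ) {A} hA =
    ⇒-trans (Avac x a A (sentence-∉ {A} hA x)) ([≔]-mono x a (assign-vacuous σ hA))

  assign-[≔]-comm : ∀ σ x a A → x ∉ vars σ → ⊢ assign σ ([ x ≔ a ] A) ⇒' [ x ≔ a ] assign σ A
  assign-[≔]-comm []            x a A x∉σ = ⇒-refl _
  assign-[≔]-comm ((y , b) ∷ σ) x a A x∉σ =
    ⇒-trans ([≔]-mono y b (assign-[≔]-comm σ x a A (λ x∈σ → x∉σ (there x∈σ))))
            (Acomm y x b a (assign σ A) (λ y≡x → x∉σ (here (sym y≡x))))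

  rn-self : ∀ x z → rn x x z ≡ z
  rn-self x z = by-cases (z ≟ x)
    where
    by-cases : (d : Dec (z ≡ x)) → (if does d then x else z) ≡ z
    by-cases (yes z≡x) = sym z≡x
    by-cases (no  _)   = refl

  rn-hit : ∀ y x → rn y x x ≡ y
  rn-hit y x = by-cases (x ≟ x)
    where
    by-cases : (d : Dec (x ≡ x)) → (if does d then y else x) ≡ y
    by-cases (yes _)   = refl
    by-cases (no  x≢x) = ⊥-elim (x≢x refl)

  map-rn-self : ∀ x X → map (rn x x) X ≡ X
  map-rn-self x []      = refl
  map-rn-self x (z ∷ X) = cong₂ _∷_ (rn-self x z) (map-rn-self x X)

  [/]-self : ∀ x A → A [ x / x ] ≡ A
  [/]-self x (pr p z)        = cong (pr p) (rn-self x z)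
  [/]-self x ⊤'              = refl
  [/]-self x (¬' A)          = cong ¬'_ ([/]-self x A)
  [/]-self x (A ∧' B)        = cong₂ _∧'_ ([/]-self x A) ([/]-self x B)
  [/]-self x ([ z ≔ a ] A) with z ≟ x
  ... | yes _ = refl
  ... | no  _ = cong ([ z ≔ a ]_) ([/]-self x A)
  [/]-self x (K X α hα)      = cong (λ Y → K Y α hα) (map-rn-self x X)

  Adm-self : ∀ x A → Adm x x A
  Adm-self x (pr p z)       = tt
  Adm-self x ⊤'             = tt
  Adm-self x (¬' A)         = Adm-self x A
  Adm-self x (A ∧' B)       = Adm-self x A , Adm-self x B
  Adm-self x ([ z ≔ b ] A) with z ≟ x
  ... | yes _ = tt
  ... | no  _ = Adm-self x A
  Adm-self x (K X α hα)     = tt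

  [≔]-idem : ∀ x a A → ⊢ [ x ≔ a ] ([ x ≔ a ] A ⇒' A)
  [≔]-idem x a A = subst (λ B → ⊢ [ x ≔ a ] ([ x ≔ a ] A ⇒' B)) ([/]-self x A) (Asub x x a A (Adm-self x A))

  assign-redundant : ∀ σ {x a} A → Unique (vars σ) → (x , a) ∈ σ → ⊢ assign σ ([ x ≔ a ] A ⇒' A)
  assign-redundant ((x , a) ∷ σ) A (x∉σ ∷ _) (here refl) =
    mp (assign-[≔]-comm σ x a _ (All¬⇒¬Any x∉σ)) (assign-gen σ ([≔]-idem x a A))
  assign-redundant ((y , b) ∷ σ) A (_ ∷ σ!) (there x,a∈σ) = gen y b (assign-redundant σ A σ! x,a∈σ)

  assign-redundant⋆ : ∀ σ τ A → Unique (vars σ) → (∀ {p} → p ∈ τ → p ∈ σ) → ⊢ assign σ (assign τ A ⇒' A)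
  assign-redundant⋆ σ []            A σ! τ⊆σ = assign-gen σ (⇒-refl A)
  assign-redundant⋆ σ ((x , a) ∷ τ) A σ! τ⊆σ =
    assign-⇒-trans σ (assign-redundant σ (assign τ A) σ! (τ⊆σ (here refl)))
                     (assign-redundant⋆ σ τ A σ! (λ p∈τ → τ⊆σ (there p∈τ)))

  assignK : List (Var × Agent) → (α : Form) → Sentence α → Form
  assignK σ α hα = assign σ (K (vars σ) α hα)

  -- Axiom 4 from T and 5, as in S5, carried out under the assignment σ.
  assign-K4 : ∀ σ α (hα : Sentence α) → Unique (vars σ) →
    ⊢ assign σ (K (vars σ) α hα ⇒' K (vars σ) (assignK σ α hα) (sent-assignK σ α hα))
  assign-K4 σ α hα σ! =
    assign-⇒-trans σ (assign-⇒-trans σ Kα⇒¬Kγ (K5 σ γ hγ σ!)) (assign-gen σ Kε⇒Kβ)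
    where
    V  = vars σ
    γ  = assign σ (¬' K V α hα)
    hγ = sent-assign¬K σ α hα
    ε  = assign σ (¬' K V γ hγ)
    hε = sent-assign¬K σ γ hγ
    Kγ⇒¬Kα : ⊢ assign σ (K V γ hγ ⇒' ¬' K V α hα)
    Kγ⇒¬Kα = assign-⇒-trans σ (assign-gen σ (KT V γ hγ))
                               (assign-redundant⋆ σ σ (¬' K V α hα) σ! (λ p∈σ → p∈σ))
    Kα⇒¬Kγ : ⊢ assign σ (K V α hα ⇒' ¬' K V γ hγ)
    Kα⇒¬Kγ = assign-map σ (tautology ((p₀ ⇒ˢ ¬ˢ p₁) ⇒ˢ p₁ ⇒ˢ ¬ˢ p₀) (K V γ hγ ∷ K V α hα ∷ [])) Kγ⇒¬Kα
    ¬Kγ⇒Kα : ⊢ assign σ (¬' K V γ hγ ⇒' K V α hα)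
    ¬Kγ⇒Kα = assign-map σ (tautology ((¬ˢ p₀ ⇒ˢ p₁) ⇒ˢ ¬ˢ p₁ ⇒ˢ p₀) (K V α hα ∷ K V γ hγ ∷ []))
                          (K5 σ α hα σ!)
    Kε⇒Kβ : ⊢ K V ε hε ⇒' K V (assignK σ α hα) (sent-assignK σ α hα)
    Kε⇒Kβ = K-mono V hε (sent-assignK σ α hα) (mp (assign-dist σ _ _) ¬Kγ⇒Kα)

  assign-K-rename : ∀ σ {j a} z X α (hα : Sentence α) → Unique (vars σ) → (j , a) ∈ σ →
    ⊢ assign σ ([ z ≔ a ] K X α hα ⇒' K (map (rn j z) X) α hα)
  assign-K-rename ((j , a) ∷ σ) z X α hα (j∉σ ∷ _) (here refl) =
    mp (assign-[≔]-comm σ j a _ (All¬⇒¬Any j∉σ)) (assign-gen σ (Asub z j a (K X α hα) tt))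
  assign-K-rename ((y , b) ∷ σ) z X α hα (_ ∷ σ!) (there j,a∈σ) =
    gen y b (assign-K-rename σ z X α hα σ! j,a∈σ)

  assign-++ : ∀ σ τ A → assign (σ ++ τ) A ≡ assign σ (assign τ A)
  assign-++ []            τ A = refl
  assign-++ ((x , a) ∷ σ) τ A = cong ([ x ≔ a ]_) (assign-++ σ τ A)

  Unique-++⁻ˡ : ∀ (l r : List Var) → Unique (l ++ r) → Unique l
  Unique-++⁻ˡ []      r _          = []
  Unique-++⁻ˡ (y ∷ l) r (y∉ ∷ l!) = ++⁻ˡ l y∉ ∷ Unique-++⁻ˡ l r l!

  vars-snoc : ∀ σ z a τ → vars (σ ++ (z , a) ∷ []) ++ vars τ ≡ vars σ ++ z ∷ vars τ
  vars-snoc σ z a τ = trans (cong (_++ vars τ) (map-++ proj₁ σ _)) (++-assoc (vars σ) (z ∷ []) (vars τ))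

  ∈-vars-snoc : ∀ σ z a {w} → w ∈ vars (σ ++ (z , a) ∷ []) → w ∈ vars σ ⊎ w ≡ z
  ∈-vars-snoc σ z a w∈ with ∈-++⁻ (vars σ) (subst (_ ∈_) (map-++ proj₁ σ _) w∈)
  ... | inj₁ w∈σ        = inj₁ w∈σ
  ... | inj₂ (here w≡z) = inj₂ w≡z

  ∈-map-rn : ∀ j z Y → j ∈ Y → ∀ w → w ∈ map (rn j z) (z ∷ Y) → w ∈ Y
  ∈-map-rn j z Y j∈Y w w∈ with ∈-map⁻ (rn j z) w∈
  ... | u , u∈ , refl = by-cases (u ≟ z) u∈
    where
    by-cases : (d : Dec (u ≡ z)) → u ∈ z ∷ Y → (if does d then j else u) ∈ Y
    by-cases (yes _)   _          = j∈Y
    by-cases (no  u≢z) (here u≡z) = ⊥-elim (u≢z u≡z)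
    by-cases (no  _)   (there u∈Y) = u∈Y

  -- Each assignment z := a of τ is absorbed into the context σ, which already names a by
  -- some j ∈ Y: the assignment [z := a] turns K_{z,Y} into K_{j,Y} = K_Y.  The processed
  -- assignment then joins the context.
  assign-K-absorb : ∀ τ σ X Y α (hα : Sentence α) →
    Unique (vars σ ++ vars τ) →
    (∀ {z a} → (z , a) ∈ τ → Σ Var λ j → (j , a) ∈ σ) →
    (∀ w → w ∈ vars σ → w ∈ Y) →
    (∀ w → w ∈ X → w ∈ vars τ ⊎ w ∈ Y) →
    ⊢ assign σ (assign τ (K X α hα) ⇒' K Y α hα)
  assign-K-absorb [] σ X Y α hα _ _ _ X⊆Y =
    assign-gen σ (Kmono X Y α hα λ w w∈X → [ (λ ()) , (λ w∈Y → w∈Y) ]′ (X⊆Y w w∈X))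
  assign-K-absorb ((z , a) ∷ τ) σ X Y α hα στ! τ↪σ σ⊆Y X⊆τY =
    assign-⇒-trans σ (assign-map σ (Adist z a _ _) absorbed-rest) absorbed-z
    where
    σ' = σ ++ (z , a) ∷ []
    σ'! : Unique (vars σ' ++ vars τ)
    σ'! = subst Unique (sym (vars-snoc σ z a τ)) στ!
    τ↪σ' : ∀ {z' a'} → (z' , a') ∈ τ → Σ Var λ j → (j , a') ∈ σ'
    τ↪σ' z',a'∈τ = let j , j,a'∈σ = τ↪σ (there z',a'∈τ) in j , ∈-++⁺ˡ j,a'∈σ
    σ'⊆zY : ∀ w → w ∈ vars σ' → w ∈ z ∷ Y
    σ'⊆zY w w∈σ' with ∈-vars-snoc σ z a w∈σ'
    ... | inj₁ w∈σ = there (σ⊆Y w w∈σ)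
    ... | inj₂ w≡z = here w≡z
    X⊆τzY : ∀ w → w ∈ X → w ∈ vars τ ⊎ w ∈ z ∷ Y
    X⊆τzY w w∈X with X⊆τY w w∈X
    ... | inj₁ (here w≡z)  = inj₂ (here w≡z)
    ... | inj₁ (there w∈τ) = inj₁ w∈τ
    ... | inj₂ w∈Y         = inj₂ (there w∈Y)
    absorbed-rest : ⊢ assign σ ([ z ≔ a ] (assign τ (K X α hα) ⇒' K (z ∷ Y) α hα))
    absorbed-rest = subst ⊢_ (assign-++ σ ((z , a) ∷ []) _)
      (assign-K-absorb τ σ' X (z ∷ Y) α hα σ'! τ↪σ' σ'⊆zY X⊆τzY)
    j = proj₁ (τ↪σ (here refl))
    j,a∈σ = proj₂ (τ↪σ (here refl))
    absorbed-z : ⊢ assign σ ([ z ≔ a ] K (z ∷ Y) α hα ⇒' K Y α hα)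
    absorbed-z = assign-⇒-trans σ
      (assign-K-rename σ z (z ∷ Y) α hα (Unique-++⁻ˡ (vars σ) _ στ!) j,a∈σ)
      (assign-gen σ (Kmono _ Y α hα (∈-map-rn j z Y (σ⊆Y j (∈-map⁺ proj₁ j,a∈σ)))))

  assignK-transfer : ∀ σ τ α (hα : Sentence α) → Unique (vars τ ++ vars σ) →
    (∀ {z a} → (z , a) ∈ σ → Σ Var λ j → (j , a) ∈ τ) →
    ⊢ assignK σ α hα ⇒' assignK τ α hα
  assignK-transfer σ τ α hα τσ! σ↪τ =
    ⇒-trans (assign-vacuous τ (sent-assignK σ α hα))
            (mp (assign-dist τ _ _) (assign-K-absorb σ τ (vars σ) (vars τ) α hα τσ! σ↪τ
                                       (λ _ w∈τ → w∈τ) (λ _ w∈σ → inj₁ w∈σ)))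

  label-≥ : ∀ i as {w} → w ∈ vars (label i as) → i ≤ w
  label-≥ i (a ∷ as) (here refl) = ≤-refl
  label-≥ i (a ∷ as) (there w∈) = ≤-trans (n≤1+n i) (label-≥ (suc i) as w∈)

  label-< : ∀ i as {w} → w ∈ vars (label i as) → w < i + length as
  label-< i (a ∷ as) (here refl) = subst (i <_) (sym (+-suc i (length as))) (s≤s (m≤m+n i (length as)))
  label-< i (a ∷ as) {w} (there w∈) = subst (w <_) (sym (+-suc i (length as))) (label-< (suc i) as w∈)

  label-unique : ∀ i as → Unique (vars (label i as))
  label-unique i []       = []
  label-unique i (a ∷ as) = All.tabulate (λ w∈ → <⇒≢ (label-≥ (suc i) as w∈)) ∷ label-unique (suc i) as

  label-names : ∀ i as {a} → a ∈ as → Σ Var λ j → (j , a) ∈ label i as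
  label-names i (b ∷ as) (here refl) = i , here refl
  label-names i (b ∷ as) (there a∈) = let j , j,a∈ = label-names (suc i) as a∈ in j , there j,a∈

  label-agent : ∀ i as {z a} → (z , a) ∈ label i as → a ∈ as
  label-agent i (b ∷ as) (here z,a≡) = here (cong proj₂ z,a≡)
  label-agent i (b ∷ as) (there z,a∈) = there (label-agent (suc i) as z,a∈)

  Disjoint-label : ∀ i as j bs → i + length as ≤ j → Disjoint (vars (label i as)) (vars (label j bs))
  Disjoint-label i as j bs i+as≤j (w∈as , w∈bs) =
    <-irrefl refl (<-≤-trans (label-< i as w∈as) (≤-trans i+as≤j (label-≥ j bs w∈bs)))

  -- Both labellings start at variable 0, so A is first relabelled by variables beyond
  -- those of A and of B.
  assignK-label-mono : ∀ A B α (hα : Sentence α) → (∀ {a} → a ∈ A → a ∈ B) →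
    ⊢ assignK (label 0 A) α hα ⇒' assignK (label 0 B) α hα
  assignK-label-mono A B α hα A⊆B =
    ⇒-trans (assignK-transfer (label 0 A) (label N A) α hα NA-0A! (λ z,a∈ → label-names N A (label-agent 0 A z,a∈)))
            (assignK-transfer (label N A) (label 0 B) α hα 0B-NA! (λ z,a∈ → label-names 0 B (A⊆B (label-agent N A z,a∈))))
    where
    N = length A + length B
    NA-0A! : Unique (vars (label N A) ++ vars (label 0 A))
    NA-0A! = Unique.++⁺ (label-unique N A) (label-unique 0 A)
               (λ (w∈NA , w∈0A) → Disjoint-label 0 A N A (m≤m+n (length A) (length B)) (w∈0A , w∈NA))
    0B-NA! : Unique (vars (label 0 B) ++ vars (label N A))
    0B-NA! = Unique.++⁺ (label-unique 0 B) (label-unique N A)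
               (Disjoint-label 0 B N A (m≤n+m (length B) (length A)))

  ⋀-proj : ∀ {C : Set} (f : C → Form) l {c} → c ∈ l → ⊢ ⋀ (map f l) ⇒' f c
  ⋀-proj f (c ∷ l) (here refl) = ∧-projˡ _ _
  ⋀-proj f (c ∷ l) (there c∈l) = ⇒-trans (∧-projʳ _ _) (⋀-proj f l c∈l)

  ⋀-intro : ∀ {C : Set} P (f : C → Form) l → (∀ c → c ∈ l → ⊢ P ⇒' f c) → ⊢ P ⇒' ⋀ (map f l)
  ⋀-intro P f []      P⇒f = ⇒-const ⊢⊤
  ⋀-intro P f (c ∷ l) P⇒f = ⇒-∧ (P⇒f c (here refl)) (⋀-intro P f l (λ c' c'∈l → P⇒f c' (there c'∈l)))

  memB-∉ : ∀ a B → a ∉ B → memB a B ≡ false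
  memB-∉ a []      _   = refl
  memB-∉ a (b ∷ B) a∉B with a Fin.≟ b
  ... | yes a≡b = ⊥-elim (a∉B (here a≡b))
  ... | no  _   = memB-∉ a B (λ a∈B → a∉B (there a∈B))

  ∉⇒∈-compl : ∀ a B → a ∉ B → a ∈ compl B
  ∉⇒∈-compl a B a∉B = ∈-filter⁺ (λ b → T? (not (memB b B))) (∈-allFin a)
    (subst (λ t → T (not t)) (sym (memB-∉ a B a∉B)) tt)

  ⇒-explode : ∀ {P N T} → ⊢ P ⇒' ¬' N → ⊢ P ⇒' N → ⊢ P ⇒' T
  ⇒-explode {P} {N} {T} = mp₂ (tautology ((p₀ ⇒ˢ ¬ˢ p₁) ⇒ˢ (p₀ ⇒ˢ p₁) ⇒ˢ p₀ ⇒ˢ p₂) (P ∷ N ∷ T ∷ []))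

  [≔]K⇒assignK : ∀ σ x a χ (hχ : Sentence χ) → Unique (vars σ) → Σ Var (λ i → (i , a) ∈ σ) →
    ⊢ [ x ≔ a ] K (x ∷ []) χ hχ ⇒' assignK σ χ hχ
  [≔]K⇒assignK σ x a χ hχ σ! (i , i,a∈σ) =
    ⇒-trans (⇒-trans (Avac i a _ (sentence-∉ {[ x ≔ a ] K (x ∷ []) χ hχ} (bound x) i)) rename)
            (⇒-trans (assign-vacuous σ (bound i)) (mp (assign-dist σ _ _) absorb))
    where
    bound : ∀ y → Sentence ([ y ≔ a ] K (y ∷ []) χ hχ)
    bound y = sent-bind y a (K (y ∷ []) χ hχ) λ { _ (here w≡y) → w≡y }
    rename : ⊢ [ i ≔ a ] ([ x ≔ a ] K (x ∷ []) χ hχ) ⇒' [ i ≔ a ] K (i ∷ []) χ hχ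
    rename = ⇒-trans (mp (Adist i a _ _) (Asub x i a (K (x ∷ []) χ hχ) tt))
                     ([≔]-mono i a (Kmono _ _ χ hχ λ { _ (here w≡x) → here (trans w≡x (rn-hit i x)) }))
    absorb : ⊢ assign σ ([ i ≔ a ] K (i ∷ []) χ hχ ⇒' K (vars σ) χ hχ)
    absorb = assign-⇒-trans σ (assign-redundant σ (K (i ∷ []) χ hχ) σ! i,a∈σ)
               (assign-gen σ (Kmono _ _ χ hχ λ { _ (here w≡i) → subst (_∈ vars σ) (sym w≡i) (∈-map⁺ proj₁ i,a∈σ) }))

  ⋀-assignK : ∀ {C : Set} σ (f : C → Form) (hf : ∀ c → Sentence (f c)) l →
    (∀ c → c ∈ l → ⊢ f c ⇒' assignK σ (f c) (hf c)) →
    ⊢ ⋀ (map f l) ⇒' assignK σ (⋀ (map f l)) (sent-⋀map f hf l)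
  ⋀-assignK σ f hf []      _      = ⇒-const (assign-gen σ (K-nec (vars σ) refl ⊢⊤))
  ⋀-assignK σ f hf (c ∷ l) f⇒Kf =
    ⇒-combine (⇒-trans (∧-projˡ _ _) (f⇒Kf c (here refl)))
              (⇒-trans (∧-projʳ _ _) (⋀-assignK σ f hf l λ c' c'∈l → f⇒Kf c' (there c'∈l)))
              (assign-mono₂ σ (K-mono₂ (vars σ) (hf c) (sent-⋀map f hf l) (sent-⋀map f hf (c ∷ l))
                                       (tautology (p₀ ⇒ˢ p₁ ⇒ˢ p₀ ∧ˢ p₁) (f c ∷ ⋀ (map f l) ∷ []))))

  module KnownFormula (x : Var) (φ : Form) (hφ : InL x φ)
    (φ-known : ∀ a → ⊢ [ x ≔ a ] (φ ⇒' K (x ∷ []) ([ x ≔ a ] φ) (sent-bind x a φ hφ))) where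

    sat : Agent → Form
    sat a = ⟨ x ≔ a ⟩ φ

    sent-sat : ∀ a → Sentence (sat a)
    sent-sat a = sent-bind x a (¬' φ) hφ

    sat⇒[≔]Ksat : ∀ a → ⊢ sat a ⇒' [ x ≔ a ] K (x ∷ []) (sat a) (sent-sat a)
    sat⇒[≔]Ksat a = ⇒-trans (Afun x a φ)
      (⇒-combine (mp (Adist x a _ _) (φ-known a)) (⇒-const (Kex x a))
                 ([≔]-mono₂ x a (K-mono₂ (x ∷ []) (sent-bind x a φ hφ) refl (sent-sat a) ([≔]-⟨≔⟩ x a φ))))

    ⋀sat⇒assignK⋀sat : ∀ σ A → Unique (vars σ) → (∀ {a} → a ∈ A → Σ Var λ i → (i , a) ∈ σ) →
      ⊢ ⋀ (map sat A) ⇒' assignK σ (⋀ (map sat A)) (sent-⋀map sat sent-sat A)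
    ⋀sat⇒assignK⋀sat σ A σ! A↪σ = ⋀-assignK σ sat sent-sat A λ a a∈A →
      ⇒-trans (sat⇒[≔]Ksat a) ([≔]K⇒assignK σ x a (sat a) (sent-sat a) σ! (A↪σ a∈A))

    open DecMembership (Fin._≟_ {n}) using (_∈?_)

    ⋀sat∧assignK⇒Kφ : ∀ A α (hα : Sentence α) →
      ⊢ ⋀ (map sat A) ∧' assignK (label 0 A) α hα ⇒' Kφ x φ hφ α hα
    ⋀sat∧assignK⇒Kφ A α hα = ⋀-intro _ (Kφ-clause x φ α hα) (subsets (allFin n)) λ B _ → clause B
      where
      clause : ∀ B → ⊢ ⋀ (map sat A) ∧' assignK (label 0 A) α hα ⇒' Kφ-clause x φ α hα B
      clause B with all? (_∈? B) A
      ... | yes A⊆B = ⇒-curry (⇒-trans (∧-projˡ _ _) (⇒-trans (∧-projʳ _ _)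
                        (assignK-label-mono A B α hα (All.lookup A⊆B))))
      ... | no  A⊈B with find (¬All⇒Any¬ (_∈? B) A A⊈B)
      ...   | a , a∈A , a∉B = ⇒-curry (⇒-explode
                (⇒-trans (∧-projˡ _ _) (⇒-trans (∧-projˡ _ _) (⋀-proj sat A a∈A)))
                (⇒-trans (∧-projʳ _ _) (⇒-trans (∧-projʳ _ _)
                  (⋀-proj (λ b → [ x ≔ b ] ¬' φ) (compl B) (∉⇒∈-compl a B a∉B)))))

    Kφ⇒KφKφ : ∀ α (hα : Sentence α) → ⊢ Kφ x φ hφ α hα ⇒' Kφ x φ hφ (Kφ x φ hφ α hα) (sent-Kφ x φ hφ α hα)
    Kφ⇒KφKφ α hα = ⋀-intro _ (Kφ-clause x φ Kφα hKφα) (subsets (allFin n)) λ A A∈S →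
      ⇒-curry (⇒-combine
        (⇒-trans (∧-projʳ _ _) (⇒-trans (∧-projˡ _ _)
          (⋀sat⇒assignK⋀sat (label 0 A) A (label-unique 0 A) (label-names 0 A))))
        (⇒-trans (⇒-uncurry (⋀-proj (Kφ-clause x φ α hα) (subsets (allFin n)) A∈S))
          (mp (assign-dist (label 0 A) _ _) (assign-K4 (label 0 A) α hα (label-unique 0 A))))
        (assign-mono₂ (label 0 A) (K-mono₂ (vars (label 0 A)) (sent-⋀map sat sent-sat A)
          (sent-assignK (label 0 A) α hα) hKφα (⇒-curry (⋀sat∧assignK⇒Kφ A α hα)))))
      where
      Kφα  = Kφ x φ hφ α hα
      hKφα = sent-Kφ x φ hφ α hα

mainTheorem12 : (n : ℕ) → 1 ≤ n → (Pred : Set) → Pred ↣ ℕ →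
    let open LEL n Pred in
    (x : Var) (φ : Form) (hφ : InL x φ) →
    (∀ (a : Agent) → ⊢ [ x ≔ a ] (φ ⇒' K (x ∷ []) ([ x ≔ a ] φ) (sent-bind x a φ hφ))) →
    (α : Form) (hα : Sentence α) →
    ⊢ Kφ x φ hφ α hα ⇒' Kφ x φ hφ (Kφ x φ hφ α hα) (sent-Kφ x φ hφ α hα)
mainTheorem12 n _ Pred _ x φ hφ φ-known =
  Derivable.KnownFormula.Kφ⇒KφKφ n Pred x φ hφ φ-known
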